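{- Let $c$ be a walk-nonrepetitive colouring of a graph $G$. Then no non-boring lazy walk in $G$ is repetitively coloured by $c$.
   Context: All graphs are finite, simple and undirected. A walk is a sequence $(v_1,\dots,v_t)$ of vertices with $v_iv_{i+1}$ an edge for each $i$. Two vertices touch if they are adjacent or equal; a lazy walk is a sequence $(v_1,\dots,v_t)$ of vertices such that $v_i$ and $v_{i+1}$ touch for each $i\in\{1,\dots,t-1\}$. Given a colouring $c$, a sequence $(v_1,\dots,v_{2t})$ is repetitively coloured if $c(v_i)=c(v_{t+i})$ for all $i\in\{1,\dots,t\}$, and it is boring if $v_i=v_{t+i}$ for all $i\in\{1,\dots,t\}$. A colouring is walk-nonrepetitive if every repetitively coloured walk is boring. -}

module Defs where

open import Data.Nat using (ℕ; _+_)
open import Data.Fin using (Fin; toℕ; _↑ˡ_; _↑ʳ_)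
open import Data.Sum using (_⊎_)
open import Relation.Binary.PropositionalEquality using (_≡_)
open import Relation.Nullary using (¬_)

record Graph (n : ℕ) : Set₁ where
  field
    Adj   : Fin n → Fin n → Set
    irrefl : ∀ {u} → ¬ Adj u u
    sym    : ∀ {u v} → Adj u v → Adj v u
open Graph public

Seq : ℕ → ℕ → Set
Seq n m = Fin m → Fin n

IsWalk : ∀ {n} → Graph n → ∀ {m} → Seq n m → Set
IsWalk G {m} v = ∀ (i j : Fin m) → toℕ j ≡ Data.Nat.suc (toℕ i) → Adj G (v i) (v j)

Touch : ∀ {n} → Graph n → Fin n → Fin n → Set
Touch G u w = Adj G u w ⊎ u ≡ w

IsLazyWalk : ∀ {n} → Graph n → ∀ {m} → Seq n m → Set
IsLazyWalk G {m} v = ∀ (i j : Fin m) → toℕ j ≡ Data.Nat.suc (toℕ i) → Touch G (v i) (v j)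

RepColoured : ∀ {n c} {C : Set c} → (Fin n → C) → ∀ t → Seq n (t + t) → Set c
RepColoured c t v = ∀ (i : Fin t) → c (v (i ↑ˡ t)) ≡ c (v (t ↑ʳ i))

Boring : ∀ {n} t → Seq n (t + t) → Set
Boring t v = ∀ (i : Fin t) → v (i ↑ˡ t) ≡ v (t ↑ʳ i)

WalkNonrepetitive : ∀ {n c} {C : Set c} → Graph n → (Fin n → C) → Set c
WalkNonrepetitive G c = ∀ t (v : Seq _ (t + t)) → IsWalk G v → RepColoured c t v → Boring t v

-- A stay of a lazy walk (two equal consecutive vertices) at position j of one half forces a
-- stay at position j of the other half: the two mirrored vertices touch and have equal colours,
-- and touching vertices of equal colour coincide because an edge is a walk of length 2.
-- Deleting both stays gives a shorter repetitively coloured lazy walk, boring by induction,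
-- and the deleted pair is recovered from the stays. A stay across the junction of the halves
-- is removed twice, once with the first and once with the last vertex of each half. A lazy
-- walk without stays is a walk, and walk-nonrepetitiveness applies directly.
module Submission where

open import Defs hiding (sym)
open import Data.Nat using (ℕ; zero; suc; _+_; _∸_; _<_; _≤_; z≤n; s≤s; s≤s⁻¹; s<s⁻¹; _<?_)
open import Data.Nat.Properties
open import Data.Fin as Fin using (Fin; toℕ; fromℕ<; _↑ˡ_; _↑ʳ_)
open import Data.Fin.Properties using (toℕ<n; toℕ-fromℕ<; fromℕ<-toℕ; toℕ-↑ˡ; toℕ-↑ʳ)
  renaming (_≟_ to _≟ᶠ_)
open import Data.Sum using (_⊎_; inj₁; inj₂)
open import Data.Product using (∃-syntax; _×_; _,_)
open import Data.Unit using (⊤; tt)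
open import Data.Empty using (⊥-elim)
open import Function using (_∘_)
open import Relation.Nullary using (¬_; yes; no)
open import Relation.Binary.PropositionalEquality
open import Relation.Binary.Definitions using (Tri; tri<; tri≈; tri>)

punchIn : ℕ → ℕ → ℕ
punchIn zero    i       = suc i
punchIn (suc p) zero    = zero
punchIn (suc p) (suc i) = suc (punchIn p i)

punchIn-< : ∀ {p i} → i < p → punchIn p i ≡ i
punchIn-< {suc p} {zero}  _   = refl
punchIn-< {suc p} {suc i} i<p = cong suc (punchIn-< (s<s⁻¹ i<p))

punchIn-≥ : ∀ {p i} → p ≤ i → punchIn p i ≡ suc i
punchIn-≥ {zero}          _   = refl
punchIn-≥ {suc p} {suc i} p≤i = cong suc (punchIn-≥ (s≤s⁻¹ p≤i))

punchIn-+ : ∀ a p i → punchIn (a + p) (a + i) ≡ a + punchIn p i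
punchIn-+ zero    p i = refl
punchIn-+ (suc a) p i = cong suc (punchIn-+ a p i)

punchIn-≤ : ∀ p i → punchIn p i ≤ suc i
punchIn-≤ zero    i       = ≤-refl
punchIn-≤ (suc p) zero    = z≤n
punchIn-≤ (suc p) (suc i) = s≤s (punchIn-≤ p i)

-- f ∘ skipPair s k is f with the positions k and suc s + k deleted.
skipPair : ℕ → ℕ → ℕ → ℕ
skipPair s k j = punchIn (suc s + k) (punchIn k j)

skipPair-lower : ∀ {s j} k → j < s → skipPair s k j ≡ punchIn k j
skipPair-lower {s} {j} k j<s =
  punchIn-< (≤-trans (s≤s (≤-trans (punchIn-≤ k j) j<s)) (m≤m+n (suc s) k))

skipPair-upper : ∀ {s k} → k ≤ s → ∀ j → skipPair s k (s + j) ≡ suc s + punchIn k j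
skipPair-upper {s} {k} k≤s j = begin
  punchIn (suc s + k) (punchIn k (s + j)) ≡⟨ cong (punchIn (suc s + k)) past-k ⟩
  punchIn (suc s + k) (suc s + j)         ≡⟨ punchIn-+ (suc s) k j ⟩
  suc s + punchIn k j                     ∎
  where
  open ≡-Reasoning
  past-k = punchIn-≥ (≤-trans k≤s (m≤m+n s j))

upperHalf : ∀ {s i} → s < i → suc i < suc s + suc s → ∃[ j ] j < s × suc s + j ≡ i
upperHalf {s} {i} s<i i+1<2t = i ∸ suc s , j<s , t+j≡i
  where
  t+j≡i : suc s + (i ∸ suc s) ≡ i
  t+j≡i = m+[n∸m]≡n s<i
  j<s : i ∸ suc s < s
  j<s = +-cancelˡ-< (suc s) _ s
          (subst (_< suc s + s) (sym t+j≡i) (subst (i <_) (+-suc s s) (s<s⁻¹ i+1<2t)))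

Paired : ∀ {a r} {A : Set a} → (A → A → Set r) → ℕ → (ℕ → A) → Set r
Paired R t f = ∀ i → i < t → R (f i) (f (t + i))

module _ {a r} {A : Set a} {R : A → A → Set r} where

  paired-skipPair : ∀ {s k f} → k ≤ s → Paired R (suc s) f → Paired R s (f ∘ skipPair s k)
  paired-skipPair {s} {k} {f} k≤s paired j j<s =
    subst₂ R (cong f (sym (skipPair-lower k j<s))) (cong f (sym (skipPair-upper k≤s j)))
      (paired (punchIn k j) (s≤s (≤-trans (punchIn-≤ k j) j<s)))

  paired-skipPair⁻ : ∀ {s k f} → k ≤ s → Paired R s (f ∘ skipPair s k) →
                     ∀ i → i < suc s → i ≢ k → R (f i) (f (suc s + i))
  paired-skipPair⁻ {s} {k} {f} k≤s paired i i<t i≢k = cover i i<t i≢k (<-cmp i k)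
    where
    P : ℕ → Set r
    P x = R (f x) (f (suc s + x))
    at : ∀ j → j < s → P (punchIn k j)
    at j j<s = subst₂ R (cong f (skipPair-lower k j<s)) (cong f (skipPair-upper k≤s j)) (paired j j<s)
    cover : ∀ i → i < suc s → i ≢ k → Tri (i < k) (i ≡ k) (k < i) → P i
    cover i       _   _   (tri< i<k _ _) = subst P (punchIn-< i<k) (at i (<-≤-trans i<k k≤s))
    cover i       _   i≢k (tri≈ _ i≡k _) = ⊥-elim (i≢k i≡k)
    cover (suc j) i<t _   (tri> _ _ k<i) = subst P (punchIn-≥ (s≤s⁻¹ k<i)) (at j (s≤s⁻¹ i<t))

  paired-except : ∀ {t k f} → (∀ i → i < t → i ≢ k → R (f i) (f (t + i))) →
                  R (f k) (f (t + k)) → Paired R t f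
  paired-except {k = k} paired Rk i i<t with i ≟ k
  ... | yes refl = Rk
  ... | no i≢k   = paired i i<t i≢k

  module _ {t} {f : ℕ → A} {v : Fin (t + t) → A} (agree : ∀ k → f (toℕ k) ≡ v k) where

    private
      left : ∀ (k : Fin t) → f (toℕ k) ≡ v (k ↑ˡ t)
      left k = trans (cong f (sym (toℕ-↑ˡ k t))) (agree (k ↑ˡ t))

      right : ∀ (k : Fin t) → f (t + toℕ k) ≡ v (t ↑ʳ k)
      right k = trans (cong f (sym (toℕ-↑ʳ t k))) (agree (t ↑ʳ k))

    paired⇒pairedFin : Paired R t f → ∀ (k : Fin t) → R (v (k ↑ˡ t)) (v (t ↑ʳ k))
    paired⇒pairedFin paired k = subst₂ R (left k) (right k) (paired (toℕ k) (toℕ<n k))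

    pairedFin⇒paired : (∀ (k : Fin t) → R (v (k ↑ˡ t)) (v (t ↑ʳ k))) → Paired R t f
    pairedFin⇒paired paired i i<t = subst (λ x → R (f x) (f (t + x))) (toℕ-fromℕ< i<t)
      (subst₂ R (sym (left k)) (sym (right k)) (paired k))
      where k = fromℕ< i<t

-- Sequences are handled as ℕ-indexed functions, so that deleting positions needs no casts
-- between Fin types; extend turns a Fin-indexed sequence into one.
extend : ∀ {a m} {A : Set a} → A → (Fin m → A) → ℕ → A
extend {m = m} d v i with i <? m
... | yes i<m = v (fromℕ< i<m)
... | no _    = d

extend-toℕ : ∀ {a m} {A : Set a} (d : A) (v : Fin m → A) k → extend d v (toℕ k) ≡ v k
extend-toℕ {m = m} d v k with toℕ k <? m
... | yes k<m = cong v (fromℕ<-toℕ k k<m)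
... | no k≮m  = ⊥-elim (k≮m (toℕ<n k))

module _ {n} (G : Graph n) where

  LazyWalkℕ : ℕ → (ℕ → Fin n) → Set
  LazyWalkℕ L f = ∀ i → suc i < L → Touch G (f i) (f (suc i))

  Walkℕ : ℕ → (ℕ → Fin n) → Set
  Walkℕ L f = ∀ i → suc i < L → Adj G (f i) (f (suc i))

  -- Bridged L f p: deleting position p from the lazy walk f of length L leaves a lazy walk.
  Bridged : ℕ → (ℕ → Fin n) → ℕ → Set
  Bridged L f zero    = ⊤
  Bridged L f (suc p) = suc (suc p) < L → Touch G (f p) (f (suc (suc p)))

  lazyWalkℕ-punchIn : ∀ {L p f} → LazyWalkℕ (suc L) f → Bridged (suc L) f p →
                      LazyWalkℕ L (f ∘ punchIn p)
  lazyWalkℕ-punchIn {L} {p} {f} lazy bridged i i+1<L with <-cmp (suc i) p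
  ... | tri< i+1<p _ _ rewrite punchIn-< (<-trans (n<1+n i) i+1<p) | punchIn-< i+1<p =
    lazy i (m<n⇒m<1+n i+1<L)
  ... | tri≈ _ refl _ rewrite punchIn-< (n<1+n i) | punchIn-≥ (≤-refl {suc i}) =
    bridged (s≤s i+1<L)
  ... | tri> _ _ p<i+1 rewrite punchIn-≥ (s≤s⁻¹ p<i+1) | punchIn-≥ (m≤n⇒m≤1+n (s≤s⁻¹ p<i+1)) =
    lazy (suc i) (s≤s i+1<L)

  bridged-stayʳ : ∀ {L p f} → LazyWalkℕ L f → f p ≡ f (suc p) → Bridged L f p
  bridged-stayʳ {p = zero}          _    _ = tt
  bridged-stayʳ {p = suc q} {f} lazy stay q+2<L =
    subst (Touch G (f q)) stay (lazy q (<-trans (n<1+n (suc q)) q+2<L))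

  bridged-stayˡ : ∀ {L p f} → LazyWalkℕ L f → f p ≡ f (suc p) → Bridged L f (suc p)
  bridged-stayˡ {p = p} {f} lazy stay p+2<L =
    subst (λ x → Touch G x (f (suc (suc p)))) (sym stay) (lazy (suc p) p+2<L)

  bridged-last : ∀ {p f} → Bridged (suc p) f p
  bridged-last {zero}  = tt
  bridged-last {suc p} p+2<p+2 = ⊥-elim (<-irrefl refl p+2<p+2)

  bridged-punchIn : ∀ {L′ L p q f} → suc p < q → L′ ≤ L → Bridged L f p →
                    Bridged L′ (f ∘ punchIn q) p
  bridged-punchIn {p = zero}                   _   _    _        = tt
  bridged-punchIn {p = suc p} {q} {f} p+2<q L′≤L bridged p+2<L′
    rewrite punchIn-< (<-trans (n<1+n p) (<-trans (n<1+n (suc p)) p+2<q)) | punchIn-< p+2<q =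
    bridged (<-≤-trans p+2<L′ L′≤L)

  lazyWalkℕ-skipPair : ∀ {s k f} → k ≤ s → LazyWalkℕ (suc s + suc s) f →
                       Bridged (suc s + suc s) f (suc s + k) → Bridged (suc s + suc s) f k →
                       LazyWalkℕ (s + s) (f ∘ skipPair s k)
  lazyWalkℕ-skipPair {zero} _ _ _ _ _ ()
  lazyWalkℕ-skipPair {suc s′} {k} {f} k≤s lazy bridgedʳ bridgedˡ =
    lazyWalkℕ-punchIn lazy′ (bridged-punchIn k+1<t+k (s≤s (+-monoʳ-≤ s (n≤1+n s))) bridgedˡ)
    where
    s = suc s′
    lazy′ : LazyWalkℕ (suc (s + s)) (f ∘ punchIn (suc s + k))
    lazy′ = subst (λ L → LazyWalkℕ L (f ∘ punchIn (suc s + k))) (+-suc s s)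
              (lazyWalkℕ-punchIn lazy bridgedʳ)
    k+1<t+k : suc k < suc s + k
    k+1<t+k = s≤s (s≤s (m≤n+m k s′))

  lazyWalkℕ⇒walkℕ⊎stay : ∀ L f → LazyWalkℕ L f →
                         Walkℕ L f ⊎ ∃[ i ] suc i < L × f i ≡ f (suc i)
  lazyWalkℕ⇒walkℕ⊎stay zero    f _    = inj₁ (λ _ ())
  lazyWalkℕ⇒walkℕ⊎stay (suc L) f lazy with anyUpTo? (λ i → f i ≟ᶠ f (suc i)) L
  ... | yes (i , i<L , stay) = inj₂ (i , s≤s i<L , stay)
  ... | no noStay            = inj₁ walk
    where
    walk : Walkℕ (suc L) f
    walk i i+1<L with lazy i i+1<L
    ... | inj₁ adj  = adj
    ... | inj₂ stay = ⊥-elim (noStay (i , s<s⁻¹ i+1<L , stay))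

  lazyWalkℕ-fromFin : ∀ {L f} {v : Seq n L} → (∀ k → f (toℕ k) ≡ v k) →
                      IsLazyWalk G v → LazyWalkℕ L f
  lazyWalkℕ-fromFin {L} {f} {v} agree lazy i i+1<L =
    subst₂ (Touch G) (trans (sym (agree k)) (cong f (toℕ-fromℕ< i<L)))
                     (trans (sym (agree k′)) (cong f (toℕ-fromℕ< i+1<L)))
      (lazy k k′ (trans (toℕ-fromℕ< i+1<L) (cong suc (sym (toℕ-fromℕ< i<L)))))
    where
    i<L = <-trans (n<1+n i) i+1<L
    k   = fromℕ< i<L
    k′  = fromℕ< i+1<L

  walkℕ⇒isWalk : ∀ {L f} → Walkℕ L f → IsWalk G (f ∘ toℕ {L})
  walkℕ⇒isWalk {L} {f} walk i j j≡i+1 =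
    subst (Adj G (f (toℕ i)) ∘ f) (sym j≡i+1) (walk (toℕ i) (subst (_< L) j≡i+1 (toℕ<n j)))

module _ {n ℓ} {C : Set ℓ} (G : Graph n) (c : Fin n → C) where

  SameColour : Fin n → Fin n → Set ℓ
  SameColour x y = c x ≡ c y

  RepColouredℕ : ℕ → (ℕ → Fin n) → Set ℓ
  RepColouredℕ = Paired SameColour

  Boringℕ : ℕ → (ℕ → Fin n) → Set
  Boringℕ = Paired _≡_

  WalkNonrepetitiveℕ : Set ℓ
  WalkNonrepetitiveℕ = ∀ t f → Walkℕ G (t + t) f → RepColouredℕ t f → Boringℕ t f

  walkNonrepetitive⇒walkNonrepetitiveℕ : WalkNonrepetitive G c → WalkNonrepetitiveℕ
  walkNonrepetitive⇒walkNonrepetitiveℕ nonrep t f walk rep =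
    pairedFin⇒paired {R = _≡_} {f = f} (λ _ → refl)
      (nonrep t (f ∘ toℕ) (walkℕ⇒isWalk G walk) (paired⇒pairedFin {R = SameColour} {f = f} (λ _ → refl) rep))

  module _ (nonrep : WalkNonrepetitiveℕ) where

    -- An edge xy with c x ≡ c y would be the non-boring repetitively coloured walk (x , y).
    touching-sameColour⇒≡ : ∀ {x y} → Touch G x y → c x ≡ c y → x ≡ y
    touching-sameColour⇒≡         (inj₂ x≡y) _      = x≡y
    touching-sameColour⇒≡ {x} {y} (inj₁ adj) cx≡cy = ⊥-elim (irrefl G (subst (Adj G x) (sym x≡y) adj))
      where
      edge : ℕ → Fin n
      edge zero    = x
      edge (suc _) = y
      walk : Walkℕ G 2 edge
      walk zero    _ = adj
      walk (suc _) (s≤s (s≤s ()))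
      rep : RepColouredℕ 1 edge
      rep zero    _ = cx≡cy
      rep (suc _) (s≤s ())
      x≡y : x ≡ y
      x≡y = nonrep 1 edge walk rep 0 (s≤s z≤n)

    stay-transfer : ∀ {x y x′ y′} → c x ≡ c x′ → c y ≡ c y′ → x ≡ y → Touch G x′ y′ → x′ ≡ y′
    stay-transfer cx≡cx′ cy≡cy′ refl touch = touching-sameColour⇒≡ touch (trans (sym cx≡cx′) cy≡cy′)

    module _ {s f} (lazy : LazyWalkℕ G (suc s + suc s) f) (rep : RepColouredℕ (suc s) f)
             {j} (j<s : j < s) where

      private
        t = suc s

        rep-next : c (f (suc j)) ≡ c (f (suc (t + j)))
        rep-next = trans (rep (suc j) (s≤s j<s)) (cong (c ∘ f) (+-suc t j))

      stay-mirrorʳ : f j ≡ f (suc j) → f (t + j) ≡ f (suc (t + j))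
      stay-mirrorʳ stay = stay-transfer (rep j (m<n⇒m<1+n j<s)) rep-next stay
        (lazy (t + j) (subst (_< t + t) (+-suc t j) (+-monoʳ-< t (s≤s j<s))))

      stay-mirrorˡ : f (t + j) ≡ f (suc (t + j)) → f j ≡ f (suc j)
      stay-mirrorˡ stay = stay-transfer (sym (rep j (m<n⇒m<1+n j<s))) (sym rep-next) stay
        (lazy j (<-≤-trans (s≤s j<s) (m≤m+n t t)))

    module _ {s f} (ih : ∀ g → LazyWalkℕ G (s + s) g → RepColouredℕ s g → Boringℕ s g)
             (lazy : LazyWalkℕ G (suc s + suc s) f) (rep : RepColouredℕ (suc s) f) where

      private
        t = suc s

        boring-skipPair : ∀ {k} → k ≤ s →
                          Bridged G (t + t) f (t + k) → Bridged G (t + t) f k →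
                          ∀ i → i < t → i ≢ k → f i ≡ f (t + i)
        boring-skipPair k≤s bridgedʳ bridgedˡ = paired-skipPair⁻ {R = _≡_} {f = f} k≤s
          (ih _ (lazyWalkℕ-skipPair G k≤s lazy bridgedʳ bridgedˡ) (paired-skipPair {R = SameColour} {f = f} k≤s rep))

      boringℕ-alignedStays : ∀ {j} → j < s → f j ≡ f (suc j) → f (t + j) ≡ f (suc (t + j)) →
                             Boringℕ t f
      boringℕ-alignedStays {j} j<s stayˡ stayʳ = paired-except {R = _≡_} {f = f} boring≢j (begin
        f j              ≡⟨ stayˡ ⟩
        f (suc j)        ≡⟨ boring≢j (suc j) (s≤s j<s) 1+n≢n ⟩
        f (t + suc j)    ≡⟨ cong f (+-suc t j) ⟩
        f (suc (t + j))  ≡⟨ sym stayʳ ⟩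
        f (t + j)        ∎)
        where
        open ≡-Reasoning
        boring≢j = boring-skipPair (<⇒≤ j<s) (bridged-stayʳ G lazy stayʳ) (bridged-stayʳ G lazy stayˡ)

      -- Deleting the first vertex of each half covers every index but 0, deleting the last
      -- covers every index but s; for s = 0 the stay itself is all there is to show.
      boringℕ-junctionStay : f s ≡ f t → Boringℕ t f
      boringℕ-junctionStay stay = paired-except {R = _≡_} {f = f} boring≢s junction
        where
        boring≢s = boring-skipPair ≤-refl
          (subst (λ L → Bridged G L f (t + s)) (cong suc (sym (+-suc s s))) (bridged-last G {f = f}))
          (bridged-stayʳ G lazy stay)
        boring≢0 = boring-skipPair z≤n
          (subst (Bridged G (t + t) f) (sym (+-identityʳ t)) (bridged-stayˡ G lazy stay)) tt
        junction : f s ≡ f (t + s)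
        junction with s ≟ 0
        ... | yes refl = stay
        ... | no s≢0   = boring≢0 s ≤-refl s≢0

    lazyWalkℕ-repColouredℕ⇒boringℕ : ∀ t f → LazyWalkℕ G (t + t) f → RepColouredℕ t f →
                                     Boringℕ t f
    lazyWalkℕ-repColouredℕ⇒boringℕ zero    f _    _   _ ()
    lazyWalkℕ-repColouredℕ⇒boringℕ (suc s) f lazy rep with lazyWalkℕ⇒walkℕ⊎stay G _ f lazy
    ... | inj₁ walk = nonrep (suc s) f walk rep
    ... | inj₂ (i , i+1<2t , stay) with <-cmp i s
    ...   | tri< i<s _ _ =
      boringℕ-alignedStays (lazyWalkℕ-repColouredℕ⇒boringℕ s) lazy rep i<s
        stay (stay-mirrorʳ lazy rep i<s stay)
    ...   | tri≈ _ refl _ =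
      boringℕ-junctionStay (lazyWalkℕ-repColouredℕ⇒boringℕ s) lazy rep stay
    ...   | tri> _ _ s<i with upperHalf s<i i+1<2t
    ...     | j , j<s , refl =
      boringℕ-alignedStays (lazyWalkℕ-repColouredℕ⇒boringℕ s) lazy rep j<s
        (stay-mirrorˡ lazy rep j<s stay) stay

lemma9 : ∀ {ℓ} {n : ℕ} {C : Set ℓ} (G : Graph n) (c : Fin n → C)
         → WalkNonrepetitive G c
         → ∀ (t : ℕ) (v : Seq n (t + t))
         → IsLazyWalk G v → ¬ Boring t v → ¬ RepColoured c t v
lemma9 G c nonrep zero    v _    notBoring _   = notBoring λ ()
lemma9 G c nonrep (suc s) v lazy notBoring rep =
  notBoring (paired⇒pairedFin {R = _≡_} agree
    (lazyWalkℕ-repColouredℕ⇒boringℕ G c (walkNonrepetitive⇒walkNonrepetitiveℕ G c nonrep)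
      (suc s) f (lazyWalkℕ-fromFin G agree lazy) (pairedFin⇒paired {R = SameColour G c} agree rep)))
  where
  f = extend (v Fin.zero) v
  agree = extend-toℕ (v Fin.zero) v
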